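{- Let $(a_n)_{n\in\mathbf{N}}$ be a sequence in $\mathcal{C}$ and let $w_a(x,y)$ be a palindromic factor with $y$ even. Then either there exist $z,r\in\mathbf{N}$ such that $w_a(4z,4r)$ is a palindrome and $w_a(x,y)$ is embedded into the center of $w_a(4z,4r)$, or $x\equiv 3 \pmod 4$ and $y\equiv 2\pmod 4$.
   Context: $w_a(x,y)=a_xa_{x+1}\cdots a_{x+y-1}$. A word is palindromic if it equals its reversal. The factor $w_a(x,y)$ is embedded into the center of $w_a(X,Y)$ if $X\le x$, $x+y\le X+Y$ and $x-X=(X+Y)-(x+y)$. The class $\mathcal{C}$: let $\Sigma$ be an alphabet with at least two letters and $a\in\Sigma$. For a bijection $g$ of $\Sigma$ and a word $u$, $g(u)$ is the letter-by-letter image. Let $(f_n)_{n\ge0}$ be bijections of $\Sigma$ and define $w_0=a$, $w_n=w_{n-1}f_{n-1}(w_{n-1})f_{n-1}(w_{n-1})w_{n-1}$ for $n>0$, with the requirement $f_n(w_n)\neq w_n$ for all $n\ge0$. The limit infinite sequence is in $\mathcal{C}$; $\mathcal{C}$ is the set of all such limits. -}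

module Defs where

open import Data.Nat using (ℕ; zero; suc; _+_; _*_; _∸_; _^_; _≤_; _<_)
open import Data.Fin using (Fin)
open import Data.List using (List; []; _∷_; _++_; map; reverse; upTo; length)
open import Data.Product using (Σ; _×_; ∃-syntax)
open import Function.Bundles using (_⤖_; Bijection)
open import Relation.Binary.PropositionalEquality using (_≡_)
open import Relation.Nullary using (¬_)

-- The alphabet Σ is Fin k (with 2 ≤ k imposed where used).
-- Letter-by-letter image of a word under a bijection g.
image : ∀ {k} → (Fin k ⤖ Fin k) → List (Fin k) → List (Fin k)
image g u = map (Bijection.to g) u

wseq : ∀ {k} → Fin k → (ℕ → (Fin k ⤖ Fin k)) → ℕ → List (Fin k)
wseq a f zero = a ∷ []
wseq a f (suc n) =
  let u = wseq a f n in u ++ image (f n) u ++ image (f n) u ++ u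

prefix : ∀ {k} → (ℕ → Fin k) → ℕ → List (Fin k)
prefix s m = map s (upTo m)

-- s ∈ 𝒞 : s is the limit of (w_n) for some letter a and bijections f_n
-- with f_n(w_n) ≠ w_n for all n.
InC : ∀ {k} → (ℕ → Fin k) → Set
InC {k} s = Σ (Fin k) λ a → Σ (ℕ → (Fin k ⤖ Fin k)) λ f →
  ((n : ℕ) → ¬ (image (f n) (wseq a f n) ≡ wseq a f n)) ×
  ((n : ℕ) → prefix s (length (wseq a f n)) ≡ wseq a f n)

factor : ∀ {k} → (ℕ → Fin k) → ℕ → ℕ → List (Fin k)
factor s x y = map (λ i → s (x + i)) (upTo y)

Palindromic : ∀ {k} → List (Fin k) → Set
Palindromic w = reverse w ≡ w

EmbeddedCenter : ℕ → ℕ → ℕ → ℕ → Set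
EmbeddedCenter x y X Y = (X ≤ x) × (x + y ≤ X + Y) × (x ∸ X ≡ (X + Y) ∸ (x + y))

-- Every sequence of 𝒞 is a concatenation of blocks c d d c with c ≠ d: w₁ has this shape,
-- and the recursion concatenates copies of w_n and of injective images of it. Hence the
-- letters at positions 2m and 2m + 1 always differ, so an even palindrome w(x,y) is centred
-- at an even position, i.e. 2x + y ≡ 0 (mod 4). Write x = 4a + d. If d = 3 this forces
-- y ≡ 2 (mod 4). If d ≤ 2, the mirror symmetry of w(x,y) pairs the last two letters of each
-- block of the aligned window w(4a, y + 2d) with the first two letters of its mirror block
-- (or vice versa); a block is determined by its last two letters, so the symmetry extends to
-- the whole window, which is therefore a palindrome with w(x,y) at its centre.

module Submission where

open import Defs
open import Data.Nat using (ℕ; zero; suc; _+_; _*_; _∸_; _≤_; _<_; _%_; z≤n; s≤s; >-nonZero)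
open import Data.Nat.Properties
  using ( ≤-trans; ≤-<-trans; n≤1+n; m≤m+n; +-monoʳ-≤; +-monoˡ-≤; *-monoˡ-≤
        ; m<m*n; *-cancelʳ-<; m≤n⇒m<n∨m≡n; suc-injective; +-suc; +-cancelˡ-≡
        ; m+n∸m≡n; m+[n∸m]≡n; m≤n⇒∃[o]m+o≡n; +-mono-≤
        ; ≤-pred; +-comm; *-comm; *-cancelʳ-≡; +-monoˡ-<)
open import Data.Nat.DivMod using (result; _divMod_; [m+kn]%n≡m%n; m*n%n≡0)
open import Data.Nat.Divisibility using (_∣_; divides)
open import Data.Nat.Tactic.RingSolver using (solve-∀)
open import Data.Fin using (Fin; zero; suc; toℕ)
open import Data.Fin.Properties using (toℕ<n)
open import Data.List using (List; []; _∷_; _++_; map; reverse; length; applyUpTo; applyDownFrom)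
open import Data.List.Properties
  using (∷-injectiveˡ; ∷-injectiveʳ; length-++; length-map; map-upTo; reverse-applyUpTo)
open import Data.Product using (_×_; _,_; proj₁; proj₂; ∃-syntax)
open import Data.Sum using (_⊎_; inj₁; inj₂)
open import Data.Unit using (⊤; tt)
open import Data.Empty using (⊥; ⊥-elim)
open import Function using (_∘_)
open import Function.Bundles using (Bijection; _⤖_)
open import Function.Definitions using (Injective)
open import Relation.Binary.PropositionalEquality
open import Relation.Nullary using (¬_)

private variable
  A B : Set


record IsBlock (c d d′ c′ : A) : Set where
  constructor block
  field
    outer    : c ≡ c′
    inner    : d ≡ d′
    distinct : c ≢ d

Blocky : List A → Set
Blocky []                    = ⊤
Blocky (c ∷ d ∷ d′ ∷ c′ ∷ l) = IsBlock c d d′ c′ × Blocky l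
Blocky _                     = ⊥

blocky-++ : (l : List A) {m : List A} → Blocky l → Blocky m → Blocky (l ++ m)
blocky-++ []                    _        bm = bm
blocky-++ (_ ∷ [])              ()       _
blocky-++ (_ ∷ _ ∷ [])          ()       _
blocky-++ (_ ∷ _ ∷ _ ∷ [])      ()       _
blocky-++ (_ ∷ _ ∷ _ ∷ _ ∷ l)   (b , bl) bm = b , blocky-++ l bl bm

blocky-map : (g : A → B) → Injective _≡_ _≡_ g → (l : List A) → Blocky l → Blocky (map g l)
blocky-map g inj []                  _ = tt
blocky-map g inj (_ ∷ [])            ()
blocky-map g inj (_ ∷ _ ∷ [])        ()
blocky-map g inj (_ ∷ _ ∷ _ ∷ [])    ()
blocky-map g inj (_ ∷ _ ∷ _ ∷ _ ∷ l) (block o i d , bl) =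
  block (cong g o) (cong g i) (d ∘ inj) , blocky-map g inj l bl

Block : (ℕ → A) → ℕ → Set
Block s k = IsBlock (s (k * 4)) (s (1 + k * 4)) (s (2 + k * 4)) (s (3 + k * 4))

Blocks : (ℕ → A) → Set
Blocks s = ∀ k → Block s k

blocky⇒block : (s : ℕ → A) (L k : ℕ) → Blocky (applyUpTo s L) → suc k * 4 ≤ L → Block s k
blocky⇒block s _ zero    (b , _) (s≤s (s≤s (s≤s (s≤s _)))) = b
blocky⇒block s _ (suc k) (_ , bl) (s≤s (s≤s (s≤s (s≤s le)))) =
  blocky⇒block (λ i → s (4 + i)) _ k bl le


module _ {k : ℕ} (a : Fin k) (f : ℕ → Fin k ⤖ Fin k) where

  wseq-blocky : ¬ image (f 0) (wseq a f 0) ≡ wseq a f 0 → ∀ n → Blocky (wseq a f (suc n))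
  wseq-blocky moves zero    = block refl refl (moves ∘ cong (_∷ []) ∘ sym) , tt
  wseq-blocky moves (suc n) =
    blocky-++ u bu (blocky-++ (g u) bgu (blocky-++ (g u) bgu bu))
    where
    u   = wseq a f (suc n)
    g   = image (f (suc n))
    bu  = wseq-blocky moves n
    bgu = blocky-map (Bijection.to (f (suc n))) (Bijection.injective (f (suc n))) u bu

  length-wseq-suc : ∀ n → length (wseq a f (suc n)) ≡ length (wseq a f n) * 4
  length-wseq-suc n = begin
    length (u ++ v ++ v ++ u)         ≡⟨ length-++ u ⟩
    L + length (v ++ v ++ u)          ≡⟨ cong (L +_) (length-++ v) ⟩
    L + (length v + length (v ++ u))  ≡⟨ cong (λ m → L + (length v + m)) (length-++ v) ⟩
    L + (length v + (length v + L))   ≡⟨ cong (λ m → L + (m + (m + L))) (length-map _ u) ⟩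
    L + (L + (L + L))                 ≡⟨ fourfold L ⟩
    L * 4                             ∎
    where
    open ≡-Reasoning
    u = wseq a f n
    v = image (f n) u
    L = length u
    fourfold : ∀ m → m + (m + (m + m)) ≡ m * 4
    fourfold = solve-∀

  n<length-wseq : ∀ n → n < length (wseq a f n)
  n<length-wseq zero    = s≤s z≤n
  n<length-wseq (suc n) = subst (suc n <_) (sym (length-wseq-suc n))
    (≤-<-trans ih (m<m*n L 4 {{>-nonZero (≤-<-trans z≤n ih)}} (s≤s (s≤s z≤n))))
    where
    L  = length (wseq a f n)
    ih = n<length-wseq n

inC⇒blocks : ∀ {k} {s : ℕ → Fin k} → InC s → Blocks s
inC⇒blocks {s = s} (a , f , moves , prefixes) j =
  blocky⇒block s L j (subst Blocky (sym prefix≡wseq) (wseq-blocky a f (moves 0) j)) long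
  where
  L = length (wseq a f (suc j))
  prefix≡wseq : applyUpTo s L ≡ wseq a f (suc j)
  prefix≡wseq = trans (sym (map-upTo s L)) (prefixes (suc j))
  long : suc j * 4 ≤ L
  long = subst (suc j * 4 ≤_) (sym (length-wseq-suc a f j)) (*-monoˡ-≤ 4 (n<length-wseq a f j))


-- Invariance under the reflection p ↦ c ∸ 1 ∸ p on positions ≥ lo; w(x,y) is a palindrome
-- iff s has this symmetry for c = 2x + y and lo = x.
SymmetricAbout : (ℕ → A) → ℕ → ℕ → Set
SymmetricAbout s c lo = ∀ p q → lo ≤ p → lo ≤ q → suc (p + q) ≡ c → s p ≡ s q

symmetricAbout-mono : ∀ {s : ℕ → A} {c lo lo′} → lo ≤ lo′ →
                      SymmetricAbout s c lo → SymmetricAbout s c lo′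
symmetricAbout-mono lo≤lo′ mirrored p q lo′≤p lo′≤q =
  mirrored p q (≤-trans lo≤lo′ lo′≤p) (≤-trans lo≤lo′ lo′≤q)

applyUpTo-cong : ∀ {f g : ℕ → A} n → (∀ {i} → i < n → f i ≡ g i) → applyUpTo f n ≡ applyUpTo g n
applyUpTo-cong zero    _   = refl
applyUpTo-cong (suc n) f≗g = cong₂ _∷_ (f≗g (s≤s z≤n)) (applyUpTo-cong n (f≗g ∘ s≤s))

applyUpTo-injective : ∀ {f g : ℕ → A} n → applyUpTo f n ≡ applyUpTo g n → ∀ {i} → i < n → f i ≡ g i
applyUpTo-injective (suc n) eq {zero}  _         = ∷-injectiveˡ eq
applyUpTo-injective (suc n) eq {suc i} (s≤s i<n) = applyUpTo-injective n (∷-injectiveʳ eq) i<n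

applyDownFrom≡applyUpTo : ∀ (f : ℕ → A) n → applyDownFrom f n ≡ applyUpTo (λ i → f (n ∸ suc i)) n
applyDownFrom≡applyUpTo f zero    = refl
applyDownFrom≡applyUpTo f (suc n) = cong (f n ∷_) (applyDownFrom≡applyUpTo f n)

module _ {k : ℕ} (s : ℕ → Fin k) (x y : ℕ) where

  factor≡applyUpTo : factor s x y ≡ applyUpTo (λ i → s (x + i)) y
  factor≡applyUpTo = map-upTo _ y

  reverse-factor : reverse (factor s x y) ≡ applyUpTo (λ i → s (x + (y ∸ suc i))) y
  reverse-factor = begin
    reverse (factor s x y)                    ≡⟨ cong reverse factor≡applyUpTo ⟩
    reverse (applyUpTo (λ i → s (x + i)) y)   ≡⟨ reverse-applyUpTo _ y ⟩
    applyDownFrom (λ i → s (x + i)) y         ≡⟨ applyDownFrom≡applyUpTo _ y ⟩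
    applyUpTo (λ i → s (x + (y ∸ suc i))) y   ∎
    where open ≡-Reasoning

  palindromic⇒symmetric : Palindromic (factor s x y) → SymmetricAbout s (x + x + y) x
  palindromic⇒symmetric pal p q x≤p x≤q e
    with i , refl ← m≤n⇒∃[o]m+o≡n x≤p | j , refl ← m≤n⇒∃[o]m+o≡n x≤q =
    sym (subst (λ t → s (x + t) ≡ s (x + i)) y∸[1+i]≡j (mirror i<y))
    where
    mirror : ∀ {i} → i < y → s (x + (y ∸ suc i)) ≡ s (x + i)
    mirror = applyUpTo-injective y (trans (sym reverse-factor) (trans pal factor≡applyUpTo))
    shift : ∀ x i j → x + x + suc (i + j) ≡ suc ((x + i) + (x + j))
    shift = solve-∀
    [1+i+j]≡y : suc (i + j) ≡ y
    [1+i+j]≡y = +-cancelˡ-≡ (x + x) _ _ (trans (shift x i j) e)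
    i<y : i < y
    i<y = subst (i <_) [1+i+j]≡y (s≤s (m≤m+n i j))
    y∸[1+i]≡j : y ∸ suc i ≡ j
    y∸[1+i]≡j = subst (λ y → y ∸ suc i ≡ j) [1+i+j]≡y (m+n∸m≡n i j)

  symmetric⇒palindromic : SymmetricAbout s (x + x + y) x → Palindromic (factor s x y)
  symmetric⇒palindromic mirrored =
    trans reverse-factor (trans (applyUpTo-cong y mirror) (sym factor≡applyUpTo))
    where
    shift : ∀ x i n → suc ((x + n) + (x + i)) ≡ x + x + (suc i + n)
    shift = solve-∀
    mirror : ∀ {i} → i < y → s (x + (y ∸ suc i)) ≡ s (x + i)
    mirror {i} i<y = mirrored _ _ (m≤m+n x _) (m≤m+n x i)
      (trans (shift x i (y ∸ suc i)) (cong (x + x +_) (m+[n∸m]≡n i<y)))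


base4-carry : ∀ {t t′ n m} → t < 4 → t′ < 4 → suc (t + t′) + n * 4 ≡ m * 4 →
              t + t′ ≡ 3 × suc n ≡ m
base4-carry {t} {t′} {n} {m} t<4 t′<4 e =
  t+t′≡3 , *-cancelʳ-≡ (suc n) m 4 (subst (λ c → suc c + n * 4 ≡ m * 4) t+t′≡3 e)
  where
  divisible : suc (t + t′) % 4 ≡ 0
  divisible = trans (sym ([m+kn]%n≡m%n (suc (t + t′)) n 4))
                    (trans (cong (_% 4) e) (m*n%n≡0 m 4))
  digit : ∀ c → c < 7 → suc c % 4 ≡ 0 → c ≡ 3
  digit 0 _ ()
  digit 1 _ ()
  digit 2 _ ()
  digit 3 _ _ = refl
  digit 4 _ ()
  digit 5 _ ()
  digit 6 _ ()
  digit (suc (suc (suc (suc (suc (suc (suc _))))))) (s≤s (s≤s (s≤s (s≤s (s≤s (s≤s (s≤s ()))))))) _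
  t+t′≡3 : t + t′ ≡ 3
  t+t′≡3 = digit (t + t′) (+-mono-≤ t<4 (≤-pred t′<4)) divisible

record MirrorBlocks (s : ℕ → A) (u v : ℕ) : Set where
  constructor mirrorAt
  field
    mirror : ∀ t t′ → t + t′ ≡ 3 → s (t + u * 4) ≡ s (t′ + v * 4)

mirrorBlocks : ∀ {s : ℕ → A} {u v} → Block s u → Block s v →
               s (2 + u * 4) ≡ s (1 + v * 4) → s (3 + u * 4) ≡ s (v * 4) → MirrorBlocks s u v
mirrorBlocks bu bv e₂ e₃ = mirrorAt λ where
  0 _ refl → trans (IsBlock.outer bu) (trans e₃ (IsBlock.outer bv))
  1 _ refl → trans (IsBlock.inner bu) (trans e₂ (IsBlock.inner bv))
  2 _ refl → e₂
  3 _ refl → e₃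

mirrorBlocks-self : ∀ {s : ℕ → A} {u} → Block s u → MirrorBlocks s u u
mirrorBlocks-self b = mirrorBlocks b b (sym (IsBlock.inner b)) (sym (IsBlock.outer b))

mirrorBlocks-sym : ∀ {s : ℕ → A} {u v} → MirrorBlocks s u v → MirrorBlocks s v u
mirrorBlocks-sym (mirrorAt m) = mirrorAt λ t t′ e → sym (m t′ t (trans (+-comm t′ t) e))

module _ {s : ℕ → A} (blocks : Blocks s) {m : ℕ} (a : ℕ)
         (mirrored : SymmetricAbout s (m * 4) (2 + a * 4)) where

  private
    digits : ∀ t t′ u v → suc ((t + u * 4) + (t′ + v * 4)) ≡ suc (t + t′) + (u + v) * 4
    digits = solve-∀

  mirrorBlocks-ascending : ∀ {u v} → a ≤ u → a < v → suc (u + v) ≡ m → MirrorBlocks s u v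
  mirrorBlocks-ascending {u} {v} a≤u a<v centre =
    mirrorBlocks (blocks u) (blocks v)
      (mirrored _ _ tail≥ (≤-trans head≥ (n≤1+n _)) (trans (digits 2 1 u v) (cong (_* 4) centre)))
      (mirrored _ _ (≤-trans tail≥ (n≤1+n _)) head≥ (trans (digits 3 0 u v) (cong (_* 4) centre)))
    where
    tail≥ : 2 + a * 4 ≤ 2 + u * 4
    tail≥ = +-monoʳ-≤ 2 (*-monoˡ-≤ 4 a≤u)
    head≥ : 2 + a * 4 ≤ v * 4
    head≥ = ≤-trans (+-monoˡ-≤ (a * 4) (s≤s (s≤s z≤n))) (*-monoˡ-≤ 4 a<v)

  mirrorBlocks-above : ∀ {u v} → a ≤ u → a ≤ v → suc (u + v) ≡ m → MirrorBlocks s u v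
  mirrorBlocks-above a≤u a≤v centre with m≤n⇒m<n∨m≡n a≤v | m≤n⇒m<n∨m≡n a≤u
  ... | inj₁ a<v  | _         = mirrorBlocks-ascending a≤u a<v centre
  ... | inj₂ refl | inj₁ a<u  =
    mirrorBlocks-sym (mirrorBlocks-ascending a≤v a<u (trans (cong suc (+-comm a _)) centre))
  ... | inj₂ refl | inj₂ refl = mirrorBlocks-self (blocks a)

  symmetricAbout-toBlockBoundary : SymmetricAbout s (m * 4) (a * 4)
  symmetricAbout-toBlockBoundary p q a4≤p a4≤q e
    with result u t refl ← p divMod 4 | result v t′ refl ← q divMod 4 =
    MirrorBlocks.mirror (mirrorBlocks-above (blockIndex≥ t u a4≤p) (blockIndex≥ t′ v a4≤q) centre)
      _ _ t+t′≡3
    where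
    blockIndex≥ : ∀ (t : Fin 4) u → a * 4 ≤ toℕ t + u * 4 → a ≤ u
    blockIndex≥ t u le =
      ≤-pred (*-cancelʳ-< 4 a (suc u) (≤-<-trans le (+-monoˡ-< (u * 4) (toℕ<n t))))
    carry : toℕ t + toℕ t′ ≡ 3 × suc (u + v) ≡ m
    carry = base4-carry (toℕ<n t) (toℕ<n t′) (trans (sym (digits (toℕ t) (toℕ t′) u v)) e)
    t+t′≡3 = proj₁ carry
    centre = proj₂ carry

adjacent-distinct : ∀ {s : ℕ → A} → Blocks s → ∀ n → s (n * 2) ≢ s (suc (n * 2))
adjacent-distinct {s = s} blocks n with n divMod 2
... | result j zero refl =
  subst (λ p → s p ≢ s (suc p)) (sym (double j)) (IsBlock.distinct (blocks j))
  where
  double : ∀ j → j * 2 * 2 ≡ j * 4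
  double = solve-∀
... | result j (suc zero) refl =
  subst (λ p → s p ≢ s (suc p)) (sym (double j))
    (λ e → IsBlock.distinct b (trans (IsBlock.outer b) (trans (sym e) (sym (IsBlock.inner b)))))
  where
  b = blocks j
  double : ∀ j → suc (j * 2) * 2 ≡ 2 + j * 4
  double = solve-∀


CentredInBlockPalindrome : ∀ {k} → (ℕ → Fin k) → ℕ → ℕ → Set
CentredInBlockPalindrome s x y =
  ∃[ z ] ∃[ r ] (Palindromic (factor s (4 * z) (4 * r)) × EmbeddedCenter x y (4 * z) (4 * r))

embeddedCenter-margin : ∀ {x y X Y} d → X + d ≡ x → x + y + d ≡ X + Y → EmbeddedCenter x y X Y
embeddedCenter-margin {x} {y} {X} {Y} d refl e =
  m≤m+n X d , subst (x + y ≤_) e (m≤m+n (x + y) d) , (begin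
    X + d ∸ X        ≡⟨ m+n∸m≡n X d ⟩
    d                ≡⟨ m+n∸m≡n (x + y) d ⟨
    x + y + d ∸ (x + y) ≡⟨ cong (_∸ (x + y)) e ⟩
    X + Y ∸ (x + y)  ∎)
  where open ≡-Reasoning

residues-offset3 : ∀ a h r → 3 + h ≡ r * 2 → (3 + a * 4) % 4 ≡ 3 × (h * 2) % 4 ≡ 2
residues-offset3 a _ 0           ()
residues-offset3 a _ 1           ()
residues-offset3 a _ (suc (suc r)) refl =
  [m+kn]%n≡m%n 3 a 4 , trans (cong (_% 4) (double r)) ([m+kn]%n≡m%n 2 r 4)
  where
  double : ∀ r → suc (r * 2) * 2 ≡ 2 + r * 4
  double = solve-∀

module _ {k : ℕ} {s : ℕ → Fin k} (blocks : Blocks s) where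

  oddCentre-impossible : ∀ d a h r → 0 < h * 2 → d + h ≡ 1 + r * 2 →
    SymmetricAbout s ((d + a * 4) + (d + a * 4) + h * 2) (d + a * 4) → ⊥
  oddCentre-impossible d a (suc h) r _ e mirrored =
    adjacent-distinct {s = s} blocks (r + a * 2)
      (subst (λ p → s p ≡ s (suc p)) centre≡
        (mirrored _ _ (m≤m+n x h) (≤-trans (m≤m+n x h) (n≤1+n _)) (sum x h)))
    where
    x = d + a * 4
    sum : ∀ x h → suc ((x + h) + suc (x + h)) ≡ x + x + suc h * 2
    sum = solve-∀
    regroup : ∀ d a h → (d + a * 4) + h ≡ (d + h) + a * 4
    regroup = solve-∀
    halve : ∀ r a → r * 2 + a * 4 ≡ (r + a * 2) * 2
    halve = solve-∀
    centre≡ : x + h ≡ (r + a * 2) * 2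
    centre≡ = begin
      x + h             ≡⟨ regroup d a h ⟩
      (d + h) + a * 4   ≡⟨ cong (_+ a * 4) (suc-injective (trans (sym (+-suc d h)) e)) ⟩
      r * 2 + a * 4     ≡⟨ halve r a ⟩
      (r + a * 2) * 2   ∎
      where open ≡-Reasoning

  evenCentre-window : ∀ d a h r → d ≤ 2 → d + h ≡ r * 2 →
    SymmetricAbout s ((d + a * 4) + (d + a * 4) + h * 2) (d + a * 4) →
    CentredInBlockPalindrome s (d + a * 4) (h * 2)
  evenCentre-window d a h r d≤2 e mirrored =
    a , r , symmetric⇒palindromic s (4 * a) (4 * r) aligned ,
    embeddedCenter-margin d (commute a d) right
    where
    x = d + a * 4
    right : x + h * 2 + d ≡ 4 * a + 4 * r
    right = begin
      x + h * 2 + d       ≡⟨ regroup d a h ⟩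
      (d + h) * 2 + a * 4 ≡⟨ cong (λ n → n * 2 + a * 4) e ⟩
      r * 2 * 2 + a * 4   ≡⟨ spread a r ⟩
      4 * a + 4 * r       ∎
      where
      open ≡-Reasoning
      regroup : ∀ d a h → (d + a * 4) + h * 2 + d ≡ (d + h) * 2 + a * 4
      regroup = solve-∀
      spread : ∀ a r → r * 2 * 2 + a * 4 ≡ 4 * a + 4 * r
      spread = solve-∀
    centre : x + x + h * 2 ≡ (a + a + r) * 4
    centre = begin
      x + x + h * 2           ≡⟨ regroup d a h ⟩
      (x + h * 2 + d) + a * 4 ≡⟨ cong (_+ a * 4) right ⟩
      4 * a + 4 * r + a * 4   ≡⟨ collect a r ⟩
      (a + a + r) * 4         ∎
      where
      open ≡-Reasoning
      regroup : ∀ d a h → (d + a * 4) + (d + a * 4) + h * 2 ≡ ((d + a * 4) + h * 2 + d) + a * 4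
      regroup = solve-∀
      collect : ∀ a r → 4 * a + 4 * r + a * 4 ≡ (a + a + r) * 4
      collect = solve-∀
    commute : ∀ a d → 4 * a + d ≡ d + a * 4
    commute = solve-∀
    window : ∀ a r → (a + a + r) * 4 ≡ 4 * a + 4 * a + 4 * r
    window = solve-∀
    aligned : SymmetricAbout s (4 * a + 4 * a + 4 * r) (4 * a)
    aligned = subst₂ (SymmetricAbout s) (window a r) (*-comm a 4)
      (symmetricAbout-toBlockBoundary blocks {m = a + a + r} a
        (symmetricAbout-mono (+-monoˡ-≤ (a * 4) d≤2)
          (subst (λ c → SymmetricAbout s c x) centre mirrored)))

  evenCentre : ∀ (d : Fin 4) a h r → toℕ d + h ≡ r * 2 →
    SymmetricAbout s ((toℕ d + a * 4) + (toℕ d + a * 4) + h * 2) (toℕ d + a * 4) →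
    CentredInBlockPalindrome s (toℕ d + a * 4) (h * 2) ⊎
    ((toℕ d + a * 4) % 4 ≡ 3 × (h * 2) % 4 ≡ 2)
  evenCentre zero                   a h r e = inj₁ ∘ evenCentre-window 0 a h r z≤n e
  evenCentre (suc zero)             a h r e = inj₁ ∘ evenCentre-window 1 a h r (s≤s z≤n) e
  evenCentre (suc (suc zero))       a h r e = inj₁ ∘ evenCentre-window 2 a h r (s≤s (s≤s z≤n)) e
  evenCentre (suc (suc (suc zero))) a h r e = λ _ → inj₂ (residues-offset3 a h r e)

  evenPalindrome-classification : ∀ x h → 0 < h * 2 → SymmetricAbout s (x + x + h * 2) x →
    CentredInBlockPalindrome s x (h * 2) ⊎ (x % 4 ≡ 3 × (h * 2) % 4 ≡ 2)
  evenPalindrome-classification x h 0<y mirrored with x divMod 4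
  ... | result a d refl with (toℕ d + h) divMod 2
  ...   | result r zero       even = evenCentre d a h r even mirrored
  ...   | result r (suc zero) odd  = ⊥-elim (oddCentre-impossible (toℕ d) a h r 0<y odd mirrored)

lemma3 : (k : ℕ) → 2 ≤ k → (s : ℕ → Fin k) → InC s →
    (x y : ℕ) → 0 < y → 2 ∣ y → Palindromic (factor s x y) →
    (∃[ z ] ∃[ r ] (Palindromic (factor s (4 * z) (4 * r)) × EmbeddedCenter x y (4 * z) (4 * r)))
    ⊎ ((x % 4 ≡ 3) × (y % 4 ≡ 2))
lemma3 _ _ s s∈C x .(h * 2) 0<y (divides h refl) pal =
  evenPalindrome-classification (inC⇒blocks s∈C) x h 0<y (palindromic⇒symmetric s x (h * 2) pal)
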